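{- Let $G_1,\dots,G_N$ be graphs, each with a distinguished root vertex. Then $$\chi_d(G_N \sqcap \cdots \sqcap G_2\sqcap G_1)\leq \chi_d(G_1)\prod_{i=2}^N n(G_i),$$ where $n(G_i)$ is the number of vertices of $G_i$.
   Context: Graphs are finite and simple. A dominator coloring of a graph $X$ is a proper vertex coloring such that every vertex $u$ either forms a color class by itself or is adjacent to all vertices of at least one color class; $\chi_d(X)$ is the minimum number of colors in a dominator coloring of $X$. For rooted graphs $G_i=(V_i,E_i)$, $i=1,\dots,N$, each with root denoted $r$, the hierarchical product $G_N\sqcap\cdots\sqcap G_2\sqcap G_1$ has vertex set $V_N\times\cdots\times V_1$ (tuples $(x_N,\dots,x_1)$ with $x_i\in V_i$), and $(x_N,\dots,x_1)$ is adjacent to the tuple obtained by replacing $x_j$ by $y_j$ (all other coordinates unchanged) whenever $y_j x_j\in E_j$ and $x_1=x_2=\cdots=x_{j-1}=r$ (for $j=1$ the latter condition is vacuous); there are no other edges. -}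

module Defs where

open import Data.Nat using (ℕ; _*_; _≤_)
open import Data.Fin using (Fin)
open import Data.List using (List; []; _∷_; map)
open import Data.Nat.ListAction using (product)
open import Data.Empty using (⊥)
open import Data.Product using (Σ; ∃; _×_; _,_)
open import Data.Sum using (_⊎_)
open import Data.Unit using (⊤)
open import Relation.Nullary using (¬_)
open import Relation.Binary.PropositionalEquality using (_≡_; _≢_)

record RootedGraph : Set₁ where
  field
    n     : ℕ
    Adj   : Fin n → Fin n → Set
    sym   : ∀ {x y} → Adj x y → Adj y x
    irr   : ∀ {x} → ¬ Adj x x
    root  : Fin n
open RootedGraph public

record DominatorColoring {V : Set} (E : V → V → Set) (m : ℕ) : Set where
  field
    col      : V → Fin m
    proper   : ∀ u v → E u v → col u ≢ col v
    dominate : ∀ u →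
      (∀ v → col v ≡ col u → v ≡ u)
      ⊎ (Σ (Fin m) λ j → (∃ λ v → col v ≡ j) × (∀ v → col v ≡ j → E u v))

record IsDominatorChromaticNumber {V : Set} (E : V → V → Set) (m : ℕ) : Set where
  field
    attained : DominatorColoring E m
    minimal  : ∀ k → DominatorColoring E k → m ≤ k

-- Hierarchical product. The list is G₁ ∷ G₂ ∷ … ∷ G_N (G₁ first), and a
-- vertex (x_N, …, x₁) is stored as x₁ , x₂ , … , x_N , tt.
Tuple : List RootedGraph → Set
Tuple []       = ⊤
Tuple (G ∷ Gs) = Fin (n G) × Tuple Gs

-- x and y are adjacent iff for some j they differ only in coordinate j,
-- x_j y_j is an edge of G_j and x₁ = … = x_{j-1} = r.
HAdj : (Gs : List RootedGraph) → Tuple Gs → Tuple Gs → Set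
HAdj []       _          _          = ⊥
HAdj (G ∷ Gs) (x₁ , xs) (y₁ , ys) =
  (Adj G x₁ y₁ × xs ≡ ys)
  ⊎ (x₁ ≡ root G × y₁ ≡ root G × HAdj Gs xs ys)

orders : List RootedGraph → ℕ
orders Gs = product (map n Gs)

module Submission where

-- Colour (x₁ , x₂ , … , x_N) by the pair (c x₁ , (x₂ , … , x_N)), where c is an optimal
-- dominator colouring of G₁. Equally coloured vertices differ only in the first coordinate,
-- and between such vertices the product has exactly the edges of G₁. So the colouring is
-- proper, and every colour class is a class of c placed in a single fibre, which a vertex
-- of that fibre dominates whenever it dominates the class in G₁.

open import Defs
open import Data.Nat using (ℕ; _*_; _≤_)
open import Data.List using (List; []; _∷_)
open import Data.Fin using (Fin; zero; combine)
open import Data.Fin.Properties using (combine-injective)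
open import Data.Product using (Σ; ∃; _×_; _,_)
open import Data.Sum using (_⊎_; inj₁; inj₂)
open import Data.Empty using (⊥-elim)
open import Function.Definitions using (Injective)
open import Relation.Nullary using (¬_)
open import Relation.Binary.PropositionalEquality using (_≡_; _≢_; refl; cong; cong₂)

module FibrewiseColoring
  {V W : Set} {E : V → V → Set} {R : V × W → V × W → Set} {m n : ℕ}
  (code : W → Fin n) (code-injective : Injective _≡_ _≡_ code)
  (lift : ∀ {x y w} → E x y → R (x , w) (y , w))
  (restrict : ∀ {x y w} → R (x , w) (y , w) → E x y)
  (D : DominatorColoring E m)
  where

  open DominatorColoring D

  colour : V × W → Fin (m * n)
  colour (x , w) = combine (col x) (code w)

  colour-injective : ∀ {x y w w′} → colour (x , w) ≡ colour (y , w′) → col x ≡ col y × w ≡ w′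
  colour-injective {x} {y} {w} {w′} eq with combine-injective (col x) (code w) (col y) (code w′) eq
  ... | cx≡cy , cw≡cw′ = cx≡cy , code-injective cw≡cw′

  colour-proper : ∀ u v → R u v → colour u ≢ colour v
  colour-proper (x , w) (y , _) r eq with colour-injective eq
  ... | cx≡cy , refl = proper x y (restrict r) cx≡cy

  colour-dominate : ∀ u →
    (∀ v → colour v ≡ colour u → v ≡ u)
    ⊎ (Σ (Fin (m * n)) λ j → (∃ λ v → colour v ≡ j) × (∀ v → colour v ≡ j → R u v))
  colour-dominate (x , w) with dominate x
  ... | inj₁ alone = inj₁ singleton
    where
    singleton : ∀ v → colour v ≡ colour (x , w) → v ≡ (x , w)
    singleton (y , _) eq with colour-injective eq
    ... | cy≡cx , refl = cong (_, w) (alone y cy≡cx)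
  ... | inj₂ (j , (v , cv≡j) , dominated) =
    inj₂ (combine j (code w) , ((v , w) , cong (λ i → combine i (code w)) cv≡j) , dominated-fibre)
    where
    dominated-fibre : ∀ u → colour u ≡ combine j (code w) → R (x , w) u
    dominated-fibre (y , w′) eq with combine-injective (col y) (code w′) j (code w) eq
    ... | cy≡j , cw′≡cw with refl ← code-injective cw′≡cw = lift (dominated y cy≡j)

  coloring : DominatorColoring R (m * n)
  coloring = record { col = colour ; proper = colour-proper ; dominate = colour-dominate }

encode : (Gs : List RootedGraph) → Tuple Gs → Fin (orders Gs)
encode []       _         = zero
encode (G ∷ Gs) (x , xs) = combine x (encode Gs xs)

encode-injective : (Gs : List RootedGraph) → Injective _≡_ _≡_ (encode Gs)
encode-injective []       {_}      {_}      _  = refl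
encode-injective (G ∷ Gs) {x , xs} {y , ys} eq with combine-injective x (encode Gs xs) y (encode Gs ys) eq
... | x≡y , exs≡eys = cong₂ _,_ x≡y (encode-injective Gs exs≡eys)

HAdj-irreflexive : (Gs : List RootedGraph) → ∀ {xs} → ¬ HAdj Gs xs xs
HAdj-irreflexive (G ∷ Gs) (inj₁ (a , _))     = irr G a
HAdj-irreflexive (G ∷ Gs) (inj₂ (_ , _ , h)) = HAdj-irreflexive Gs h

HAdj-restrict : (G : RootedGraph) (Gs : List RootedGraph) →
  ∀ {x y xs} → HAdj (G ∷ Gs) (x , xs) (y , xs) → Adj G x y
HAdj-restrict G Gs (inj₁ (a , _))     = a
HAdj-restrict G Gs (inj₂ (_ , _ , h)) = ⊥-elim (HAdj-irreflexive Gs h)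

hierarchicalColoring : (G₁ : RootedGraph) (Gs : List RootedGraph) {k : ℕ} →
  DominatorColoring (Adj G₁) k → DominatorColoring (HAdj (G₁ ∷ Gs)) (k * orders Gs)
hierarchicalColoring G₁ Gs =
  FibrewiseColoring.coloring (encode Gs) (encode-injective Gs) (λ a → inj₁ (a , refl)) (HAdj-restrict G₁ Gs)

mainTheorem6 : (G₁ : RootedGraph) (Gs : List RootedGraph) (k m : ℕ) →
    IsDominatorChromaticNumber (Adj G₁) k →
    IsDominatorChromaticNumber (HAdj (G₁ ∷ Gs)) m →
    m ≤ k * orders Gs
mainTheorem6 G₁ Gs k m χ₁ χ =
  IsDominatorChromaticNumber.minimal χ (k * orders Gs) (hierarchicalColoring G₁ Gs (IsDominatorChromaticNumber.attained χ₁))
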